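{- Let $T=(V,E)$ be a tree and let $G=(V,A)$ be the corresponding symmetric directed graph (with both $(u,v)$ and $(v,u)$ in $A$ for each $\{u,v\}\in E$), with arc weights, and let $C\subseteq F\subseteq V$. Consider the procedure: (1) while the current tree contains a leaf vertex that is not in $C$, delete it; (2) return the set $F^*$ of leaves of the resulting residual tree. Then $F^*$ is an optimum (minimum-size) pathwise-disjoint cover for $C$.
   Context: For $c\in C$, $f\in F$, $P(c,f)$ is the set of shortest directed paths from $c$ to $f$ in $G$ (in a tree, the unique simple path). A pair $\{f_1,f_2\}\subseteq F\setminus\{c\}$ covers $c$ in a pathwise-disjoint fashion if there are $p_1\in P(c,f_1)$, $p_2\in P(c,f_2)$ having no common vertex except $c$. A set $F'\subseteq F$ is a pathwise-disjoint cover for $C$ if every $c\in C\setminus F'$ is covered in a pathwise-disjoint fashion by some pair $\{f_1,f_2\}\subseteq F'\setminus\{c\}$ (a customer in $F'$ covers itself). -}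

module Defs where

open import Data.Nat using (ℕ; _≤_; _≥_)
open import Data.Fin using (Fin)
open import Data.Fin.Subset using (Subset; _∈_; _∉_; _⊆_; _-_; ∣_∣)
open import Data.List using (List; head; last; length)
open import Data.List.Relation.Unary.Linked using (Linked)
open import Data.List.Relation.Unary.Unique.Propositional using (Unique)
import Data.List.Membership.Propositional as LMem
open import Data.Maybe using (just)
open import Data.Product using (Σ; ∃; ∃-syntax; _×_)
open import Relation.Nullary using (¬_)
open import Relation.Binary.PropositionalEquality using (_≡_; _≢_)
open import Relation.Binary.Construct.Closure.ReflexiveTransitive using (Star)

Walk : ∀ {n} → (Fin n → Fin n → Set) → Fin n → Fin n → List (Fin n) → Set
Walk E u v p = head p ≡ just u × last p ≡ just v × Linked E p

SimplePath : ∀ {n} → (Fin n → Fin n → Set) → Fin n → Fin n → List (Fin n) → Set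
SimplePath E u v p = Walk E u v p × Unique p

IsCycle : ∀ {n} → (Fin n → Fin n → Set) → List (Fin n) → Set
IsCycle E p = 3 ≤ length p × Linked E p × Unique p
            × ∃[ a ] ∃[ b ] (head p ≡ just a × last p ≡ just b × E b a)

-- A tree T = (Fin n, E) given through its symmetric arc relation
-- (this is exactly the symmetric directed graph G): connected and acyclic.
record Tree (n : ℕ) : Set₁ where
  field
    E         : Fin n → Fin n → Set
    symmetric : ∀ {u v} → E u v → E v u
    irrefl    : ∀ {u} → ¬ E u u
    connected : ∀ u v → ∃[ p ] Walk E u v p
    acyclic   : ∀ p → ¬ IsCycle E p

module _ {n : ℕ} (T : Tree n) where
  open Tree T

  P : Fin n → Fin n → List (Fin n) → Set
  P c f p = SimplePath E c f p

  CoveredBy : Subset n → Fin n → Set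
  CoveredBy F' c =
    ∃[ f₁ ] ∃[ f₂ ] (f₁ ∈ F' × f₂ ∈ F' × f₁ ≢ f₂ × f₁ ≢ c × f₂ ≢ c
      × ∃[ p₁ ] ∃[ p₂ ] (P c f₁ p₁ × P c f₂ p₂
          × (∀ x → x LMem.∈ p₁ → x LMem.∈ p₂ → x ≡ c)))

  IsPDCover : (C F F' : Subset n) → Set
  IsPDCover C F F' = F' ⊆ F × (∀ c → c ∈ C → c ∉ F' → CoveredBy F' c)

  IsOptimumPDCover : (C F F' : Subset n) → Set
  IsOptimumPDCover C F F' =
    IsPDCover C F F' × (∀ F'' → IsPDCover C F F'' → ∣ F' ∣ ≤ ∣ F'' ∣)

  -- v is a leaf of the residual tree induced on S (degree ≤ 1 in S;
  -- a single remaining vertex counts as a leaf).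
  IsLeaf : Subset n → Fin n → Set
  IsLeaf S v = v ∈ S × (∀ u w → u ∈ S → w ∈ S → E v u → E v w → u ≡ w)

  PruneStep : Subset n → Subset n → Subset n → Set
  PruneStep C S S' = ∃[ v ] (IsLeaf S v × v ∉ C × S' ≡ S - v)

  PruneDone : Subset n → Subset n → Set
  PruneDone C S = ∀ v → IsLeaf S v → v ∈ C

module Submission where

-- Pruning preserves two facts: every customer stays in S, and S stays convex (the route
-- between two of its vertices lies in S), because a leaf of S is never an inner vertex of
-- such a route.  Covering: a customer c that is not a leaf of S has two neighbours in S;
-- walking away from c through each of them inside S must end at leaves of S, and in a tree
-- two routes leaving c through different neighbours meet only at c.  Optimality: each leaf
-- ℓ of S is a customer, so any cover F″ contains ℓ or two vertices reached from ℓ along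
-- routes with different first steps, one of which leaves S at once.  Matching ℓ with such a
-- vertex is injective, since the route between two leaves of S runs inside S.

open import Defs
open import Data.Nat using (ℕ; zero; suc; _≤_; _+_; z≤n; s≤s)
open import Data.Nat.Properties using (≤-trans; n≤1+n; n≮n; m≤m+n; +-suc; module ≤-Reasoning)
open import Data.Fin using (Fin; zero; suc; _≟_)
open import Data.Fin.Properties using (any?)
open import Data.Fin.Subset using (Subset; _∈_; _∉_; _⊆_; _⊂_; _-_; ⊤; ∣_∣; inside; outside)
open import Data.Fin.Subset.Properties
  using (_∈?_; ∈⊤; ∣⊤∣≡n; ∣⊥∣≡0; p─⊥≡p; p─q⊆p; nonempty?; Empty-unique;
         x∈p∧x≢y⇒x∈p-y; x∈p⇒p-x⊂p; x∈p⇒∣p-x∣<∣p∣)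
open import Data.Fin.Subset.Induction using (Acc; acc; ⊂-wellFounded)
open import Data.Vec.Base using (_∷_; here; there)
open import Data.List using (List; []; _∷_; _++_; _∷ʳ_; length; last)
open import Data.List.Properties using (≡-dec; ∷ʳ-injectiveˡ)
open import Data.List.Membership.Propositional using () renaming (_∈_ to _∈ₗ_; _∉_ to _∉ₗ_)
open import Data.List.Membership.Propositional.Properties using (∈-++⁻; ∈-++⁺ʳ)
open import Data.List.Relation.Binary.Disjoint.Propositional using (Disjoint)
open import Data.List.Relation.Binary.Subset.Propositional using () renaming (_⊆_ to _⊆ₗ_)
open import Data.List.Relation.Unary.Any using (here; there)
open import Data.List.Relation.Unary.All using (All; []; _∷_)
import Data.List.Relation.Unary.All as All
import Data.List.Relation.Unary.All.Properties as All
open import Data.List.Relation.Unary.All.Properties using (¬Any⇒All¬; All¬⇒¬Any)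
open import Data.List.Relation.Unary.AllPairs using ([]; _∷_)
open import Data.List.Relation.Unary.Linked using (Linked; []; [-]; _∷_)
open import Data.List.Relation.Unary.Unique.Propositional using (Unique)
import Data.List.Relation.Unary.Unique.Propositional.Properties as Unique
open import Data.Maybe using (just)
open import Data.Product using (∃-syntax; _×_; _,_; proj₁; proj₂)
open import Data.Sum using (_⊎_; inj₁; inj₂)
open import Function using (_∘_)
open import Relation.Nullary using (¬_; Dec; yes; no; contradiction)
open import Relation.Nullary.Decidable using (_×-dec_; ¬?; decidable-stable)
open import Relation.Binary.PropositionalEquality using (_≡_; _≢_; refl; sym; trans; cong; subst)
open import Relation.Binary.Construct.Closure.ReflexiveTransitive using (Star; ε; _◅_)

length-∷ʳ : ∀ {A : Set} (xs : List A) {y} → length (xs ∷ʳ y) ≡ suc (length xs)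
length-∷ʳ []       = refl
length-∷ʳ (_ ∷ xs) = cong suc (length-∷ʳ xs)

unique-++-disjoint : ∀ {A : Set} {xs ys : List A} → Unique (xs ++ ys) → Disjoint xs ys
unique-++-disjoint {xs = x ∷ xs} (x∉ ∷ _) (here refl , v∈ys) = All.lookup x∉ (∈-++⁺ʳ xs v∈ys) refl
unique-++-disjoint {xs = x ∷ xs} (_ ∷ u)  (there v∈xs , v∈ys) = unique-++-disjoint u (v∈xs , v∈ys)

x∈p⇒∣p∣≡suc∣p-x∣ : ∀ {n} {p : Subset n} {x} → x ∈ p → ∣ p ∣ ≡ suc ∣ p - x ∣
x∈p⇒∣p∣≡suc∣p-x∣ {p = inside ∷ p}  {x = zero}  here      = cong suc (cong ∣_∣ (sym (p─⊥≡p p)))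
x∈p⇒∣p∣≡suc∣p-x∣ {p = inside ∷ p}  {x = suc x} (there h) = cong suc (x∈p⇒∣p∣≡suc∣p-x∣ h)
x∈p⇒∣p∣≡suc∣p-x∣ {p = outside ∷ p} {x = suc x} (there h) = x∈p⇒∣p∣≡suc∣p-x∣ h

x∉p-x : ∀ {n} {p : Subset n} {x} → x ∉ p - x
x∉p-x {p = _ ∷ _} {x = zero}  ()
x∉p-x {p = _ ∷ _} {x = suc x} (there h) = x∉p-x h

x∈p-y⇒x≢y : ∀ {n} {p : Subset n} {x y} → x ∈ p - y → x ≢ y
x∈p-y⇒x≢y x∈ refl = x∉p-x x∈

matching⇒∣p∣≤∣q∣ : ∀ {m n} {p : Subset m} {q : Subset n} (R : Fin m → Fin n → Set) →
                   (∀ {x} → x ∈ p → ∃[ y ] y ∈ q × R x y) →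
                   (∀ {x x′ y} → x ∈ p → x′ ∈ p → R x y → R x′ y → x ≡ x′) →
                   ∣ p ∣ ≤ ∣ q ∣
matching⇒∣p∣≤∣q∣ {m} {n} {p} R = go (⊂-wellFounded p)
  where
  go : ∀ {p : Subset m} {q : Subset n} → Acc _⊂_ p →
       (∀ {x} → x ∈ p → ∃[ y ] y ∈ q × R x y) →
       (∀ {x x′ y} → x ∈ p → x′ ∈ p → R x y → R x′ y → x ≡ x′) →
       ∣ p ∣ ≤ ∣ q ∣
  go {p} {q} (acc rec) match inj with nonempty? p
  ... | no p-empty = subst (_≤ ∣ q ∣) (sym (trans (cong ∣_∣ (Empty-unique p-empty)) (∣⊥∣≡0 m))) z≤n
  ... | yes (x , x∈p) with match x∈p
  ...   | y , y∈q , xRy = begin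
    ∣ p ∣          ≡⟨ x∈p⇒∣p∣≡suc∣p-x∣ x∈p ⟩
    suc ∣ p - x ∣  ≤⟨ s≤s (go (rec (x∈p⇒p-x⊂p x∈p)) match′ inj′) ⟩
    suc ∣ q - y ∣  ≤⟨ x∈p⇒∣p-x∣<∣p∣ y∈q ⟩
    ∣ q ∣          ∎
    where
    open ≤-Reasoning
    ∈p-x⇒∈p : ∀ {x′} → x′ ∈ p - x → x′ ∈ p
    ∈p-x⇒∈p = p─q⊆p p _
    match′ : ∀ {x′} → x′ ∈ p - x → ∃[ y′ ] y′ ∈ q - y × R x′ y′
    match′ {x′} x′∈ with match (∈p-x⇒∈p x′∈)
    ... | y′ , y′∈q , x′Ry′ = y′ , x∈p∧x≢y⇒x∈p-y y′∈q y′≢y , x′Ry′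
      where
      y′≢y : y′ ≢ y
      y′≢y refl = x∈p-y⇒x≢y x′∈ (inj (∈p-x⇒∈p x′∈) x∈p x′Ry′ xRy)
    inj′ : ∀ {x₁ x₂ y′} → x₁ ∈ p - x → x₂ ∈ p - x → R x₁ y′ → R x₂ y′ → x₁ ≡ x₂
    inj′ h₁ h₂ = inj (∈p-x⇒∈p h₁) (∈p-x⇒∈p h₂)

unique⇒length≤∣p∣ : ∀ {n} {p : Subset n} {xs : List (Fin n)} → Unique xs → All (_∈ p) xs → length xs ≤ ∣ p ∣
unique⇒length≤∣p∣ [] [] = z≤n
unique⇒length≤∣p∣ (x∉xs ∷ u) (x∈p ∷ xs⊆p) = ≤-trans
  (s≤s (unique⇒length≤∣p∣ u (All.zipWith (λ (y∈p , x≢y) → x∈p∧x≢y⇒x∈p-y y∈p (x≢y ∘ sym)) (xs⊆p , x∉xs))))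
  (x∈p⇒∣p-x∣<∣p∣ x∈p)

unique⇒length≤n : ∀ {n} {xs : List (Fin n)} → Unique xs → length xs ≤ n
unique⇒length≤n {n} {xs} u = subst (length xs ≤_) (∣⊤∣≡n n) (unique⇒length≤∣p∣ u (All.universal (λ _ → ∈⊤) _))

module Routes {n : ℕ} (E : Fin n → Fin n → Set) where

  open import Data.List.Membership.DecPropositional (_≟_ {n}) using () renaming (_∈?_ to _∈ₗ?_)

  -- A route a b xs is a walk from a to b whose vertex sequence is a ∷ xs.
  data Route : Fin n → Fin n → List (Fin n) → Set where
    []  : ∀ {a} → Route a a []
    _∷_ : ∀ {a c b xs} → E a c → Route c b xs → Route a b (c ∷ xs)

  SimpleRoute : Fin n → Fin n → List (Fin n) → Set
  SimpleRoute a b xs = Route a b xs × Unique (a ∷ xs)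

  Route⇒Walk : ∀ {a b xs} → Route a b xs → Walk E a b (a ∷ xs)
  Route⇒Walk r = refl , last-route r , linked-route r
    where
    last-route : ∀ {a b xs} → Route a b xs → last (a ∷ xs) ≡ just b
    last-route []      = refl
    last-route (_ ∷ r) = last-route r
    linked-route : ∀ {a b xs} → Route a b xs → Linked E (a ∷ xs)
    linked-route []      = [-]
    linked-route (e ∷ r) = e ∷ linked-route r

  Walk⇒Route : ∀ {a b p} → Walk E a b p → ∃[ xs ] p ≡ a ∷ xs × Route a b xs
  Walk⇒Route {p = a ∷ xs} (refl , last≡ , linked) = xs , refl , route last≡ linked
    where
    route : ∀ {a b xs} → last (a ∷ xs) ≡ just b → Linked E (a ∷ xs) → Route a b xs
    route {xs = []}     refl _            = []
    route {xs = _ ∷ _}  last≡ (e ∷ linked) = e ∷ route last≡ linked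

  end∈ : ∀ {a b c xs} → Route a b (c ∷ xs) → b ∈ₗ c ∷ xs
  end∈ (_ ∷ [])      = here refl
  end∈ (_ ∷ r@(_ ∷ _)) = there (end∈ r)

  end-unique : ∀ {a b b′ xs} → Route a b xs → Route a b′ xs → b ≡ b′
  end-unique []      []       = refl
  end-unique (_ ∷ r) (_ ∷ r′) = end-unique r r′

  infixr 5 _++ᴿ_
  _++ᴿ_ : ∀ {a b c xs ys} → Route a b xs → Route b c ys → Route a c (xs ++ ys)
  []      ++ᴿ r′ = r′
  (e ∷ r) ++ᴿ r′ = e ∷ (r ++ᴿ r′)

  first-step : ∀ {a b c xs} → Route a b (c ∷ xs) → E a c
  first-step (e ∷ _) = e

  end≢start : ∀ {a b c xs} → SimpleRoute a b (c ∷ xs) → b ≢ a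
  end≢start (r , a∉ ∷ _) refl = All¬⇒¬Any a∉ (end∈ r)

  snoc : ∀ {a b c xs} → SimpleRoute a b xs → E b c → c ∉ₗ a ∷ xs → SimpleRoute a c (xs ∷ʳ c)
  snoc (r , u) e c∉ = r ++ᴿ (e ∷ []) , Unique.++⁺ u ([] ∷ []) λ { (c∈ , here refl) → c∉ c∈ }

  cons : ∀ {a c b xs} → E a c → SimpleRoute c b xs → a ∉ₗ c ∷ xs → SimpleRoute a b (c ∷ xs)
  cons e (r , u) a∉ = e ∷ r , ¬Any⇒All¬ _ a∉ ∷ u

  suffix : ∀ {a b y xs} → SimpleRoute a b xs → y ∈ₗ a ∷ xs →
           ∃[ ys ] SimpleRoute y b ys × y ∷ ys ⊆ₗ a ∷ xs
  suffix sp             (here refl) = _ , sp , λ z∈ → z∈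
  suffix (_ ∷ r , _ ∷ u) (there y∈) with ys , sp , sub ← suffix (r , u) y∈ = ys , sp , λ z∈ → there (sub z∈)

  simplify : ∀ {a b xs} → Route a b xs → ∃[ ys ] SimpleRoute a b ys × a ∷ ys ⊆ₗ a ∷ xs
  simplify [] = [] , ([] , [] ∷ []) , λ z∈ → z∈
  simplify {a} (_∷_ {c = c} e r) with ys , sp , sub ← simplify r with a ∈ₗ? c ∷ ys
  ... | yes a∈ with zs , sp′ , sub′ ← suffix sp a∈ = zs , sp′ , λ z∈ → there (sub (sub′ z∈))
  ... | no a∉ = c ∷ ys , cons e sp a∉ , λ { (here refl) → here refl ; (there z∈) → there (sub z∈) }

  simplify-∷ : ∀ {a c b xs} → E a c → Route c b xs → a ∉ₗ c ∷ xs → ∃[ ys ] SimpleRoute a b (c ∷ ys)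
  simplify-∷ e r a∉ with ys , sp , sub ← simplify r = ys , cons e sp (λ a∈ → a∉ (sub a∈))

  split : ∀ {a b y xs} → SimpleRoute a b xs → y ∈ₗ a ∷ xs →
          ∃[ zs ] ∃[ ws ] xs ≡ zs ++ ws × SimpleRoute a y zs × Route y b ws
  split (r , _)            (here refl) = [] , _ , refl , ([] , [] ∷ []) , r
  split (e ∷ r , (a∉ ∷ u)) (there y∈)
    with zs , ws , refl , (r′ , u′) , r″ ← split (r , u) y∈ =
    _ ∷ zs , ws , refl , (e ∷ r′ , All.++⁻ˡ (_ ∷ zs) a∉ ∷ u′) , r″

  module _ (symmetric : ∀ {u v} → E u v → E v u) where

    reverse : ∀ {a b xs} → Route a b xs → ∃[ ys ] Route b a ys × b ∷ ys ⊆ₗ a ∷ xs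
    reverse [] = [] , [] , λ z∈ → z∈
    reverse {a} {b} (_∷_ {c = c} {xs = xs} e r) with ys , r′ , sub ← reverse r =
      ys ∷ʳ a , r′ ++ᴿ (symmetric e ∷ []) , sub′
      where
      sub′ : b ∷ ys ∷ʳ a ⊆ₗ a ∷ c ∷ xs
      sub′ (here refl) = there (sub (here refl))
      sub′ (there z∈) with ∈-++⁻ ys z∈
      ... | inj₁ z∈ys       = there (sub (there z∈ys))
      ... | inj₂ (here refl) = here refl

    via-common-end : ∀ {a c y r a′ xs} → E a c → Route c y r → Route a′ y xs →
                     a ∉ₗ c ∷ r → a ∉ₗ a′ ∷ xs → ∃[ ys ] SimpleRoute a a′ (c ∷ ys)
    via-common-end {a} {c} {r = r} e r₁ r₂ a∉r₁ a∉r₂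
      with rs , back , sub ← reverse r₂ = simplify-∷ e (r₁ ++ᴿ back) a∉walk
      where
      a∉walk : a ∉ₗ c ∷ r ++ rs
      a∉walk a∈ with ∈-++⁻ (c ∷ r) a∈
      ... | inj₁ a∈r₁ = a∉r₁ a∈r₁
      ... | inj₂ a∈rs = a∉r₂ (sub (there a∈rs))

    interior : ∀ {x y v zs} → SimpleRoute x y zs → v ∈ₗ zs → v ≢ y →
               ∃[ u ] ∃[ w ] u ∈ₗ x ∷ zs × w ∈ₗ zs × E v u × E v w × u ≢ w
    interior (e ∷ [] , _) (here refl) v≢y = contradiction refl v≢y
    interior {x} (e ∷ (e′ ∷ _) , ((_ ∷ x≢d ∷ _) ∷ _)) (here refl) _ =
      x , _ , here refl , there (here refl) , symmetric e , e′ , x≢d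
    interior (_ ∷ r , (_ ∷ u)) (there v∈) v≢y
      with a , b , a∈ , b∈ , ea , eb , a≢b ← interior (r , u) v∈ v≢y =
      a , b , there a∈ , there b∈ , ea , eb , a≢b

module TreeRoutes {n : ℕ} (T : Tree n) where

  open Tree T
  open Routes E public

  no-closing-edge : ∀ {a c d z zs} → SimpleRoute a d (c ∷ z ∷ zs) → ¬ E d a
  no-closing-edge {a} {c} {d} {z} {zs} (r , u) eda with refl , last≡ , linked ← Route⇒Walk r =
    acyclic (a ∷ c ∷ z ∷ zs) (s≤s (s≤s (s≤s z≤n)) , linked , u , a , d , refl , last≡ , eda)

  -- Distinct first steps c ≠ d would close a cycle a, c, …, d.
  route-unique : ∀ {a b xs ys} → SimpleRoute a b xs → SimpleRoute a b ys → xs ≡ ys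
  route-unique ([] , _) ([] , _) = refl
  route-unique ([] , _) (r@(_ ∷ _) , a∉ ∷ _) = contradiction (end∈ r) (All¬⇒¬Any a∉)
  route-unique (r@(_ ∷ _) , a∉ ∷ _) ([] , _) = contradiction (end∈ r) (All¬⇒¬Any a∉)
  route-unique (_∷_ {c = c} e r , a∉ ∷ u) (_∷_ {c = d} e′ r′ , a∉′ ∷ u′) with c ≟ d
  ... | yes refl = cong (c ∷_) (route-unique (r , u) (r′ , u′))
  ... | no c≢d with via-common-end symmetric e r r′ (All¬⇒¬Any a∉) (All¬⇒¬Any a∉′)
  ...   | [] , (_ ∷ [] , _) = contradiction refl c≢d
  ...   | _ ∷ _ , sp = contradiction (symmetric e′) (no-closing-edge sp)

  simple-route : ∀ a b → ∃[ xs ] SimpleRoute a b xs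
  simple-route a b with p , walk ← connected a b with xs , _ , r ← Walk⇒Route walk
    with ys , sp , _ ← simplify r = ys , sp

  edge-route : ∀ {a b} → E a b → SimpleRoute a b (b ∷ [])
  edge-route e = e ∷ [] , ((λ { refl → irrefl e }) ∷ []) ∷ [] ∷ []

  -- Two vertices are adjacent iff their unique simple route is a single step.
  adjacent? : ∀ a b → Dec (E a b)
  adjacent? a b with xs , sp ← simple-route a b with ≡-dec _≟_ xs (b ∷ [])
  ... | yes refl = yes (first-step (proj₁ sp))
  ... | no xs≢[b] = no λ e → xs≢[b] (route-unique sp (edge-route e))

  routes-disjoint : ∀ {c b₁ b₂ u w r₁ r₂} → SimpleRoute c b₁ (u ∷ r₁) → SimpleRoute c b₂ (w ∷ r₂) →
                    u ≢ w → ∀ x → x ∈ₗ c ∷ u ∷ r₁ → x ∈ₗ c ∷ w ∷ r₂ → x ≡ c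
  routes-disjoint sp₁ sp₂ u≢w x x∈₁ x∈₂
    with split sp₁ x∈₁ | split sp₂ x∈₂
  ... | _ , _ , _ , sp₁′ , _ | _ , _ , _ , sp₂′ , _ with route-unique sp₁′ sp₂′
  routes-disjoint _ _ _ _ _ _ | [] , _ , _ , ([] , _) , _ | _ | refl = refl
  routes-disjoint _ _ u≢w _ _ _ | _ ∷ _ , _ , refl , _ | _ , _ , refl , _ | refl = contradiction refl u≢w

  predecessor : ∀ {c x y xs} → SimpleRoute c x xs → E x y → y ∈ₗ c ∷ xs →
                ∃[ zs ] xs ≡ zs ∷ʳ x × Route c y zs
  predecessor sp exy y∈ with split sp y∈
  ... | _ , [] , _ , _ , [] = contradiction exy irrefl
  ... | zs , _ ∷ _ , refl , sp₁ , r₂ =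
    zs , route-unique sp (snoc sp₁ (symmetric exy) λ x∈ → unique-++-disjoint (proj₂ sp) (x∈ , end∈ r₂)) , proj₁ sp₁

  end-neighbours-equal : ∀ {c x a b xs} → SimpleRoute c x xs → E x a → E x b →
                         a ∈ₗ c ∷ xs → b ∈ₗ c ∷ xs → a ≡ b
  end-neighbours-equal sp ea eb a∈ b∈
    with zs , eq , r ← predecessor sp ea a∈ | zs′ , eq′ , r′ ← predecessor sp eb b∈
    with refl ← ∷ʳ-injectiveˡ zs zs′ (trans (sym eq) eq′) = end-unique r r′

module Subtrees {n : ℕ} (T : Tree n) where

  open Tree T
  open TreeRoutes T
  open import Data.List.Membership.DecPropositional (_≟_ {n}) using () renaming (_∈?_ to _∈ₗ?_)

  Branching : Subset n → Fin n → Set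
  Branching S x = ∃[ u ] ∃[ w ] u ∈ S × w ∈ S × E x u × E x w × u ≢ w

  branching? : ∀ S x → Dec (Branching S x)
  branching? S x = any? λ u → any? λ w →
    u ∈? S ×-dec w ∈? S ×-dec adjacent? x u ×-dec adjacent? x w ×-dec ¬? (u ≟ w)

  leaf⇒¬branching : ∀ {S x} → IsLeaf T S x → ¬ Branching S x
  leaf⇒¬branching (_ , leaf) (u , w , u∈ , w∈ , eu , ew , u≢w) = u≢w (leaf u w u∈ w∈ eu ew)

  ¬branching⇒leaf : ∀ {S x} → x ∈ S → ¬ Branching S x → IsLeaf T S x
  ¬branching⇒leaf x∈S ¬br = x∈S , λ u w u∈ w∈ eu ew →
    decidable-stable (u ≟ w) λ u≢w → ¬br (u , w , u∈ , w∈ , eu , ew , u≢w)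

  ¬leaf⇒branching : ∀ {S x} → x ∈ S → ¬ IsLeaf T S x → Branching S x
  ¬leaf⇒branching {S} {x} x∈S ¬leaf = decidable-stable (branching? S x) (¬leaf ∘ ¬branching⇒leaf x∈S)

  Convex : Subset n → Set
  Convex S = ∀ {x y xs} → x ∈ S → y ∈ S → SimpleRoute x y xs → All (_∈ S) xs

  ⊤-convex : Convex ⊤
  ⊤-convex _ _ _ = All.universal (λ _ → ∈⊤) _

  -- A leaf cannot be an inner vertex of a route, since inner vertices are branching.
  prune-convex : ∀ {S v} → Convex S → IsLeaf T S v → Convex (S - v)
  prune-convex {S} {v} convex leaf {x} {y} {xs} x∈ y∈ sp = All.tabulate λ z∈ →
    x∈p∧x≢y⇒x∈p-y (All.lookup inS z∈) λ { refl → leaf⇒¬branching leaf (branching z∈) }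
    where
    x∈S = p─q⊆p S _ x∈
    inS = convex x∈S (p─q⊆p S _ y∈) sp
    branching : v ∈ₗ xs → Branching S v
    branching v∈ with u , w , u∈ , w∈ , eu , ew , u≢w ← interior symmetric sp v∈ (x∈p-y⇒x≢y y∈ ∘ sym) =
      u , w , All.lookup (x∈S ∷ inS) u∈ , All.lookup inS w∈ , eu , ew , u≢w

  module _ (C : Subset n) where

    PruneInvariant : Subset n → Set
    PruneInvariant S = C ⊆ S × Convex S

    prune-invariant : ∀ {S} → Star (PruneStep T C) ⊤ S → PruneInvariant S
    prune-invariant = go ((λ _ → ∈⊤) , ⊤-convex)
      where
      go : ∀ {S S′} → PruneInvariant S → Star (PruneStep T C) S S′ → PruneInvariant S′
      go inv ε = inv
      go (C⊆S , convex) ((v , leaf , v∉C , refl) ◅ steps) =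
        go ((λ c∈ → x∈p∧x≢y⇒x∈p-y (C⊆S c∈) λ { refl → v∉C c∈ }) , prune-convex convex leaf) steps

  extend-to-leaf : ∀ {S c x d xs} → SimpleRoute c x (d ∷ xs) → All (_∈ S) (c ∷ d ∷ xs) →
                   ∃[ f ] IsLeaf T S f × ∃[ ys ] SimpleRoute c f (d ∷ ys)
  extend-to-leaf {S} {c} {d = d} {xs} sp inS = go n sp inS (m≤m+n n (length xs))
    where
    Goal : Set
    Goal = ∃[ f ] IsLeaf T S f × ∃[ ys ] SimpleRoute c f (d ∷ ys)

    -- The fuel k suffices because a simple route visits at most n vertices.
    go : ∀ k {x xs} → SimpleRoute c x (d ∷ xs) → All (_∈ S) (c ∷ d ∷ xs) → n ≤ k + length xs → Goal
    grow : ∀ k {x y xs} → SimpleRoute c x (d ∷ xs) → All (_∈ S) (c ∷ d ∷ xs) → n ≤ suc k + length xs →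
           y ∈ S → E x y → y ∉ₗ c ∷ d ∷ xs → Goal

    go zero {xs = xs} (_ , u) _ n≤ =
      contradiction (≤-trans (n≤1+n _) (≤-trans (unique⇒length≤n u) n≤)) (n≮n (length xs))
    go (suc k) {x} {xs} sp inS n≤ with branching? S x
    ... | no ¬br = x , ¬branching⇒leaf (All.lookup inS (there (end∈ (proj₁ sp)))) ¬br , xs , sp
    ... | yes (a , b , a∈ , b∈ , ea , eb , a≢b) with a ∈ₗ? c ∷ d ∷ xs | b ∈ₗ? c ∷ d ∷ xs
    ...   | no a∉  | _      = grow k sp inS n≤ a∈ ea a∉
    ...   | yes _  | no b∉  = grow k sp inS n≤ b∈ eb b∉
    ...   | yes a∈ | yes b∈ = contradiction (end-neighbours-equal sp ea eb a∈ b∈) a≢b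

    grow k {xs = xs} sp inS n≤ y∈ e y∉ = go k (snoc sp e y∉) (All.++⁺ inS (y∈ ∷ []))
      (subst (n ≤_) (trans (sym (+-suc k _)) (cong (k +_) (sym (length-∷ʳ xs)))) n≤)

  SimpleRoute⇒P : ∀ {a b xs} → SimpleRoute a b xs → P T a b (a ∷ xs)
  SimpleRoute⇒P (r , u) = Route⇒Walk r , u

  P⇒SimpleRoute : ∀ {a b p} → P T a b p → b ≢ a → ∃[ x ] ∃[ xs ] p ≡ a ∷ x ∷ xs × SimpleRoute a b (x ∷ xs)
  P⇒SimpleRoute (walk , u) b≢a with Walk⇒Route walk
  ... | [] , refl , [] = contradiction refl b≢a
  ... | x ∷ xs , refl , r = x , xs , refl , (r , u)

  leaves-cover-branching : ∀ {S F′ c} → (∀ {f} → IsLeaf T S f → f ∈ F′) → c ∈ S → Branching S c →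
                           CoveredBy T F′ c
  leaves-cover-branching leaf⇒∈F′ c∈S (u , w , u∈ , w∈ , eu , ew , u≢w)
    with f₁ , leaf₁ , _ , sp₁ ← extend-to-leaf (edge-route eu) (c∈S ∷ u∈ ∷ [])
       | f₂ , leaf₂ , _ , sp₂ ← extend-to-leaf (edge-route ew) (c∈S ∷ w∈ ∷ []) =
    f₁ , f₂ , leaf⇒∈F′ leaf₁ , leaf⇒∈F′ leaf₂ , f₁≢f₂ , end≢start sp₁ , end≢start sp₂ ,
    _ , _ , SimpleRoute⇒P sp₁ , SimpleRoute⇒P sp₂ , disjoint
    where
    disjoint = routes-disjoint sp₁ sp₂ u≢w
    f₁≢f₂ : f₁ ≢ f₂
    f₁≢f₂ refl = end≢start sp₁ (disjoint f₁ (there (end∈ (proj₁ sp₁))) (there (end∈ (proj₁ sp₂))))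

  Exits : Subset n → Fin n → Fin n → Set
  Exits S ℓ y = y ≡ ℓ ⊎ ∃[ a ] ∃[ r ] SimpleRoute ℓ y (a ∷ r) × a ∉ S

  leaf-exits-into-cover : ∀ {S C F F″ ℓ} → IsPDCover T C F F″ → ℓ ∈ C → IsLeaf T S ℓ →
                          ∃[ y ] y ∈ F″ × Exits S ℓ y
  leaf-exits-into-cover {S} {F″ = F″} {ℓ} (_ , covers) ℓ∈C (_ , leaf) with ℓ ∈? F″
  ... | yes ℓ∈ = ℓ , ℓ∈ , inj₁ refl
  ... | no ℓ∉ with f₁ , f₂ , f₁∈ , f₂∈ , _ , f₁≢ℓ , f₂≢ℓ , _ , _ , p₁ , p₂ , disjoint ← covers ℓ ℓ∈C ℓ∉
    with a₁ , r₁ , refl , sp₁ ← P⇒SimpleRoute p₁ f₁≢ℓ | a₂ , r₂ , refl , sp₂ ← P⇒SimpleRoute p₂ f₂≢ℓ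
    with a₁ ∈? S | a₂ ∈? S
  ... | no a₁∉  | _       = f₁ , f₁∈ , inj₂ (a₁ , r₁ , sp₁ , a₁∉)
  ... | yes _   | no a₂∉  = f₂ , f₂∈ , inj₂ (a₂ , r₂ , sp₂ , a₂∉)
  ... | yes a₁∈ | yes a₂∈ with refl ← leaf a₁ a₂ a₁∈ a₂∈ (first-step (proj₁ sp₁)) (first-step (proj₁ sp₂)) =
    contradiction (subst (E ℓ) (disjoint a₁ (there (here refl)) (there (here refl))) (first-step (proj₁ sp₁))) irrefl

  exits-injective : ∀ {S ℓ₁ ℓ₂ y} → Convex S → ℓ₁ ∈ S → ℓ₂ ∈ S → Exits S ℓ₁ y → Exits S ℓ₂ y → ℓ₁ ≡ ℓ₂
  exits-injective _ _ _ (inj₁ refl) (inj₁ refl) = refl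
  exits-injective convex ℓ₁∈ ℓ₂∈ (inj₁ refl) (inj₂ (_ , _ , sp , a∉)) = contradiction (All.head (convex ℓ₂∈ ℓ₁∈ sp)) a∉
  exits-injective convex ℓ₁∈ ℓ₂∈ (inj₂ (_ , _ , sp , a∉)) (inj₁ refl) = contradiction (All.head (convex ℓ₁∈ ℓ₂∈ sp)) a∉
  exits-injective {ℓ₁ = ℓ₁} {ℓ₂} convex ℓ₁∈ ℓ₂∈ (inj₂ (a₁ , r₁ , sp₁ , a₁∉)) (inj₂ (a₂ , r₂ , sp₂ , a₂∉))
    with ℓ₁ ∈ₗ? ℓ₂ ∷ a₂ ∷ r₂
  ... | yes ℓ₁∈route₂ with split sp₂ ℓ₁∈route₂
  ...   | [] , _ , _ , ([] , _) , _ = refl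
  ...   | _ ∷ _ , _ , refl , sp , _ = contradiction (All.head (convex ℓ₂∈ ℓ₁∈ sp)) a₂∉
  exits-injective convex ℓ₁∈ ℓ₂∈ (inj₂ (_ , _ , (e₁ ∷ r₁ , ℓ₁∉ ∷ _) , a₁∉)) (inj₂ (_ , _ , (r₂ , _) , _))
    | no ℓ₁∉route₂ with _ , sp ← via-common-end symmetric e₁ r₁ r₂ (All¬⇒¬Any ℓ₁∉) ℓ₁∉route₂ =
    contradiction (All.head (convex ℓ₁∈ ℓ₂∈ sp)) a₁∉

theorem3 : {n : ℕ} (T : Tree n) (C F : Subset n) → C ⊆ F →
           (S : Subset n) → Star (PruneStep T C) ⊤ S → PruneDone T C S →
           (F* : Subset n) → (∀ v → (v ∈ F* → IsLeaf T S v) × (IsLeaf T S v → v ∈ F*)) →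
           IsOptimumPDCover T C F F*
theorem3 T C F C⊆F S pruned done F* F*-leaves = (F*⊆F , covers) , minimum
  where
  open Subtrees T
  C⊆S = proj₁ (prune-invariant C pruned)
  convex = proj₂ (prune-invariant C pruned)
  leaf : ∀ {v} → v ∈ F* → IsLeaf T S v
  leaf = proj₁ (F*-leaves _)

  F*⊆F : F* ⊆ F
  F*⊆F f∈ = C⊆F (done _ (leaf f∈))

  covers : ∀ c → c ∈ C → c ∉ F* → CoveredBy T F* c
  covers c c∈C c∉F* = leaves-cover-branching (proj₂ (F*-leaves _)) (C⊆S c∈C)
    (¬leaf⇒branching (C⊆S c∈C) (c∉F* ∘ proj₂ (F*-leaves c)))

  minimum : ∀ F″ → IsPDCover T C F F″ → ∣ F* ∣ ≤ ∣ F″ ∣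
  minimum F″ cover = matching⇒∣p∣≤∣q∣ (Exits S)
    (λ f∈ → leaf-exits-into-cover cover (done _ (leaf f∈)) (leaf f∈))
    (λ f∈ f′∈ → exits-injective convex (proj₁ (leaf f∈)) (proj₁ (leaf f′∈)))
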